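{- For every $k\in\mathbb N\cup\{\infty\}$ with $k\ge1$, the clustering scheme $\Pi_k$ is excisive. That is, for every hypergraph $G$ and every part $p$ of $\Pi_k(G)$, $p$ is a part of $\Pi_k(G|_p)$.
   Context: A hypergraph is a triple $G=(V,E,\epsilon)$, where $V$ is a finite vertex set, $E$ is a finite edge set disjoint from $V$, and $\epsilon:E\to2^V$ gives edge vertex sets. Distinct edges may have the same vertex set. For $p\subseteq V$, the restriction $G|_p$ has vertex set $p$ and those edges $e$ with $\epsilon(e)\subseteq p$. For $k\in\mathbb N\cup\{\infty\}$, the $k$-line graph $\Lambda_k(G)$ is the simple graph with vertex set $\{\epsilon(e):e\in E\}$ in which distinct $u,v$ are adjacent iff $|u\cap v|\ge k$ (no edges if $k=\infty$). $\Pi_k(G)$ is the pair $(V(G),P)$ where $P$ consists of the sets $\bigcup_{x\in C}x$, for $C$ ranging over the vertex sets of the connected components (including singletons) of $\Lambda_k(G)$. -}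

module Defs where

open import Data.Nat using (ℕ; _≤_)
open import Data.Fin using (Fin)
open import Data.Fin.Subset using (Subset; _∈_; _⊆_; _∩_; ∣_∣)
open import Data.Fin.Subset.Properties using (_⊆?_)
open import Data.List using (List; filter)
import Data.List.Membership.Propositional as LM
open import Data.List.Relation.Unary.All using (All)
open import Data.List.Relation.Unary.All.Properties using (all-filter)
open import Data.Product using (Σ; _×_; ∃; ∃-syntax)
open import Data.Empty using (⊥)
import Data.Unit
open import Relation.Binary.PropositionalEquality using (_≢_)
open import Relation.Binary.Construct.Closure.ReflexiveTransitive using (Star)
open import Function.Bundles using (_⇔_)

data ℕ∞ : Set where
  fin : ℕ → ℕ∞
  ∞   : ℕ∞

_≤∞_ : ℕ∞ → ℕ → Set
fin k ≤∞ m = k ≤ m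
∞     ≤∞ m = ⊥

1≤∞ : ℕ∞ → Set
1≤∞ (fin k) = 1 ≤ k
1≤∞ ∞       = Data.Unit.⊤

-- Edges are a list (so distinct edges may carry the same vertex set);
-- each entry is the vertex set ε(e) of an edge e, contained in V.
record Hypergraph (n : ℕ) : Set where
  field
    V     : Subset n
    edges : List (Subset n)
    edges⊆V : All (_⊆ V) edges
open Hypergraph public

restrict : ∀ {n} → Hypergraph n → Subset n → Hypergraph n
restrict G p = record
  { V = p
  ; edges = filter (_⊆? p) (edges G)
  ; edges⊆V = all-filter (_⊆? p) (edges G) }

-- Adjacency in the k-line graph Λ_k(G): vertices are the edge vertex sets
-- {ε(e)}; distinct u, v adjacent iff |u ∩ v| ≥ k.
Adj : ∀ {n} → ℕ∞ → Hypergraph n → Subset n → Subset n → Set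
Adj k G u v = LM._∈_ u (edges G) × LM._∈_ v (edges G) × u ≢ v × (k ≤∞ ∣ u ∩ v ∣)

Reach : ∀ {n} → ℕ∞ → Hypergraph n → Subset n → Subset n → Set
Reach k G = Star (Adj k G)

IsPart : ∀ {n} → ℕ∞ → Hypergraph n → Subset n → Set
IsPart {n} k G p =
  ∃[ u ] (LM._∈_ u (edges G) ×
          ((x : Fin n) → (x ∈ p) ⇔ (∃[ v ] (Reach k G u v × x ∈ v))))

Excisive : ℕ∞ → Set
Excisive k = ∀ {n} (G : Hypergraph n) (p : Subset n) →
  IsPart k G p → IsPart k (restrict G p) p

{-# OPTIONS --safe #-}
module Submission where

-- Every edge reachable from u in Λ_k(G) lies inside the part p it generates,
-- so it survives in G|_p; hence the component of u is the same in Λ_k(G) and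
-- in Λ_k(G|_p), and so is the union of its edges.

open import Defs
open import Data.Nat using (ℕ)
open import Data.Fin using (Fin)
open import Data.Fin.Subset using (Subset; _∈_; _⊆_)
open import Data.Fin.Subset.Properties using (_⊆?_)
open import Data.Product using (_,_; _×_; proj₁; ∃-syntax)
open import Function using (_∘_)
open import Function.Bundles using (_⇔_; mk⇔; Equivalence)
open import Relation.Binary.Construct.Closure.ReflexiveTransitive using (ε; _◅_; map)
import Data.List.Membership.Propositional as List
open import Data.List.Membership.Propositional.Properties using (∈-filter⁺; ∈-filter⁻)

module _ {n : ℕ} (k : ℕ∞) (G : Hypergraph n) (p : Subset n) where

  ∈-restrict⁻ : ∀ {u} → List._∈_ u (edges (restrict G p)) → List._∈_ u (edges G)
  ∈-restrict⁻ = proj₁ ∘ ∈-filter⁻ (_⊆? p)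

  ∈-restrict⁺ : ∀ {u} → List._∈_ u (edges G) → u ⊆ p → List._∈_ u (edges (restrict G p))
  ∈-restrict⁺ = ∈-filter⁺ (_⊆? p)

  Adj-restrict⁻ : ∀ {u v} → Adj k (restrict G p) u v → Adj k G u v
  Adj-restrict⁻ (u∈ , v∈ , u≢v , k≤) = ∈-restrict⁻ u∈ , ∈-restrict⁻ v∈ , u≢v , k≤

  Reach-restrict⁻ : ∀ {u v} → Reach k (restrict G p) u v → Reach k G u v
  Reach-restrict⁻ = map Adj-restrict⁻

  Reach-restrict⁺ : ∀ {u v} → (∀ {w} → Reach k G u w → w ⊆ p) →
                    Reach k G u v → Reach k (restrict G p) u v
  Reach-restrict⁺ reach⊆p ε = ε
  Reach-restrict⁺ reach⊆p (u~w@(u∈ , w∈ , u≢w , k≤) ◅ w↝v) =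
    (∈-restrict⁺ u∈ (reach⊆p ε) , ∈-restrict⁺ w∈ (reach⊆p (u~w ◅ ε)) , u≢w , k≤)
    ◅ Reach-restrict⁺ (λ w↝w′ → reach⊆p (u~w ◅ w↝w′)) w↝v

  Reach-⊆-part : ∀ {u} →
                 ((x : Fin n) → (x ∈ p) ⇔ (∃[ v ] (Reach k G u v × x ∈ v))) →
                 ∀ {w} → Reach k G u w → w ⊆ p
  Reach-⊆-part p≡⋃ u↝w x∈w = Equivalence.from (p≡⋃ _) (_ , u↝w , x∈w)

-- The hypothesis k ≥ 1 is unused: the argument works for every threshold k.
mainTheorem9 : (k : ℕ∞) → 1≤∞ k →
    ∀ {n} (G : Hypergraph n) (p : Subset n) →
    IsPart k G p → IsPart k (restrict G p) p
mainTheorem9 k _ G p (u , u∈ , p≡⋃) =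
  u , ∈-restrict⁺ k G p u∈ (reach⊆p ε) , λ x → mk⇔
    (λ x∈p → let (v , u↝v , x∈v) = Equivalence.to (p≡⋃ x) x∈p
             in v , Reach-restrict⁺ k G p reach⊆p u↝v , x∈v)
    (λ (v , u↝v , x∈v) → Equivalence.from (p≡⋃ x) (v , Reach-restrict⁻ k G p u↝v , x∈v))
  where
  reach⊆p : ∀ {w} → Reach k G u w → w ⊆ p
  reach⊆p = Reach-⊆-part k G p p≡⋃
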